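{- Let $\mathbf H=\mathbf K_2$ be the $01$-graph with domain $\{a,b\}$, $E(a,b)=E(b,a)=1$ and $E(a,a)=E(b,b)=0$. Then $\mathrm{Obs}^\subset_{01}(\mathbf H)$ is finite and $\mathrm{Obs}^\subset_\varnothing(\mathbf H)$ is infinite.
   Context: A graph-type structure over a poset $(P,\preceq)$ is a finite set $G$ with a map $E^{\mathbf G}\colon G^2\to P$; a homomorphism $h\colon\mathbf G\to\mathbf H$ is a map $h\colon G\to H$ with $E^{\mathbf G}(x,y)\preceq E^{\mathbf H}(h(x),h(y))$ for all $x,y\in G$. $01$-graphs use $P_{01}=\{0,1\}$ ($0,1$ incomparable); $\varnothing$-graphs use $P_\varnothing=\{\varnothing,0,1,\star\}$ with $\varnothing\preceq0\preceq\star$, $\varnothing\preceq1\preceq\star$, $0,1$ incomparable; every $01$-graph is a $\varnothing$-graph. For $*\in\{01,\varnothing\}$, a $*$-graph $\mathbf G$ is an inclusion-minimal obstruction for $\mathbf H$ if $\mathbf G\not\to\mathbf H$ and for every $v\in G$ the subgraph induced by $G\setminus\{v\}$ maps to $\mathbf H$; $\mathrm{Obs}^\subset_*(\mathbf H)$ is the set of these, up to isomorphism. -}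

module Defs where

open import Data.Nat using (ℕ; zero; suc)
open import Data.Fin using (Fin; zero; suc; punchIn)
open import Data.Product using (Σ; _×_; _,_)
open import Relation.Nullary using (¬_)
open import Relation.Binary.PropositionalEquality using (_≡_)
open import Function.Bundles using (_⤖_; Bijection)

-- A graph-type structure over a carrier P: finite domain Fin size, edge map E.
-- (Every finite set is in bijection with some Fin n; we work up to isomorphism.)
record Struct (P : Set) : Set where
  constructor mkStruct
  field
    size : ℕ
    E    : Fin size → Fin size → P
open Struct public

Hom : {P : Set} → (P → P → Set) → Struct P → Struct P → Set
Hom _≼_ G H = Σ (Fin (size G) → Fin (size H))
  λ h → ∀ x y → E G x y ≼ E H (h x) (h y)

Iso : {P : Set} → Struct P → Struct P → Set
Iso G H = Σ (Fin (size G) ⤖ Fin (size H))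
  λ f → ∀ x y → E G x y ≡ E H (Bijection.to f x) (Bijection.to f y)

delete : {P : Set} → (G : Struct P) → Fin (size G) → Struct P
delete (mkStruct (suc m) e) v = mkStruct m (λ i j → e (punchIn v i) (punchIn v j))

IsMinObs : {P : Set} → (P → P → Set) → Struct P → Struct P → Set
IsMinObs _≼_ G H = (¬ Hom _≼_ G H) × (∀ v → Hom _≼_ (delete G v) H)

data P01 : Set where
  o₀ o₁ : P01

_≼₀₁_ : P01 → P01 → Set
x ≼₀₁ y = x ≡ y

data P∅ : Set where
  e∅ e₀ e₁ e⋆ : P∅

data _≼∅_ : P∅ → P∅ → Set where
  refl≼ : ∀ {x} → x ≼∅ x
  ∅≼    : ∀ {x} → e∅ ≼∅ x
  ≼⋆    : ∀ {x} → x ≼∅ e⋆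

embed : P01 → P∅
embed o₀ = e₀
embed o₁ = e₁

mapStruct : {P Q : Set} → (P → Q) → Struct P → Struct Q
mapStruct f (mkStruct n e) = mkStruct n (λ x y → f (e x y))

K2 : Struct P01
K2 = mkStruct 2 k
  where
  k : Fin 2 → Fin 2 → P01
  k zero zero = o₀
  k zero (suc zero) = o₁
  k (suc zero) zero = o₁
  k (suc zero) (suc zero) = o₀

K2∅ : Struct P∅
K2∅ = mapStruct embed K2

{-# OPTIONS --safe #-}
module Submission where

-- Reading o₀ as "equal" and o₁ as "different", a map to K2 is a 2-colouring meeting
-- prescribed constraints, and in K2 the value E b c is E a b + E a c in ℤ/2.  So if every
-- one-vertex deletion of a 01-graph on at least four vertices maps to K2, colouring x by
-- E 0 x works: the constraint on x, y is checked inside a deletion missing 0, x and y.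
-- Minimal 01-obstructions therefore have at most three vertices and are enumerated.
-- An ∅-graph may leave pairs unconstrained: the cycle 0, 1, …, n with "equal" between
-- neighbours and "different" between 0 and n is an obstruction, every deletion of a
-- vertex w leaves a path coloured by cutting it at w, and n is arbitrary.

open import Defs
open import Data.Product using (Σ; _×_; _,_; ∃; proj₁)
open import Data.List using (List; []; _∷_; _++_; map; length; lookup; cartesianProductWith)
open import Data.List.Relation.Unary.Any using (Any; here; there; index; any?)
import Data.List.Relation.Unary.Any as Any
open import Data.List.Relation.Unary.Any.Properties using (++⁺ˡ; ++⁺ʳ; map⁺; cartesianProductWith⁺; lookup-index)
open import Data.List.Relation.Unary.All using (All; []; _∷_)
import Data.List.Relation.Unary.All as All
open import Data.List.Membership.Propositional using (_∈_; _∉_)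
open import Data.Nat using (ℕ; zero; suc; _+_; _≤_; _<_; _≟_; _<?_; z≤n; s≤s)
open import Data.Nat.ListAction using (sum)
open import Data.Nat.Properties using (≟-diag; <-irrefl; ≤-trans; ≤∧≢⇒<; ≰⇒>; <⇒≱; <⇒≤; m≤m+n; m≤n+m; m≤n⇒m≤o+n; m<1+n⇒m<n∨m≡n)
open import Data.Fin using (Fin; zero; suc; punchIn; punchOut; toℕ; fromℕ; inject₁)
import Data.Fin as Fin
open import Data.Fin.Properties using (¬∀⟶∃¬; pigeonhole; punchIn-punchOut; punchInᵢ≢i; toℕ-injective; toℕ≤pred[n]; toℕ-fromℕ; toℕ-inject₁; injective⇒≤)
open import Data.Vec.Functional using (Vector)
import Data.Vec.Functional as Vector
open import Data.Vec.Functional.Relation.Binary.Pointwise using (Pointwise)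
open import Data.Sum using (inj₁; inj₂)
open import Data.Empty using (⊥-elim)
open import Function using (_∘_)
open import Relation.Nullary using (¬_; yes; no)
open import Relation.Binary.PropositionalEquality using (_≡_; _≢_; refl; sym; trans; cong; cong₂; subst₂; module ≡-Reasoning)
open import Function.Bundles using (Bijection)
open import Function.Construct.Identity using (⤖-id)

functions : ∀ {A : Set} n → List A → List (Vector A n)
functions zero    xs = Vector.[] ∷ []
functions (suc n) xs = cartesianProductWith Vector._∷_ xs (functions n xs)

functions-complete : ∀ {A : Set} {R : A → A → Set} {xs : List A} →
  (∀ a → Any (R a) xs) → ∀ n (f : Vector A n) → Any (Pointwise R f) (functions n xs)
functions-complete covers zero    f = here (λ ())
functions-complete {R = R} covers (suc n) f =
  cartesianProductWith⁺ Vector._∷_ cons-pointwise (covers (f zero))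
    (functions-complete covers n (f ∘ suc))
  where
  cons-pointwise : ∀ {a g} → R (f zero) a → Pointwise R (f ∘ suc) g → Pointwise R f (a Vector.∷ g)
  cons-pointwise r rs zero    = r
  cons-pointwise r rs (suc i) = rs i

Iso-pointwise : ∀ {P : Set} {n} {e e′ : Fin n → Fin n → P} →
  (∀ x y → e x y ≡ e′ x y) → Iso (mkStruct n e) (mkStruct n e′)
Iso-pointwise {n = n} e≗e′ = ⤖-id (Fin n) , e≗e′

p01-complete : ∀ p → Any (p ≡_) (o₀ ∷ o₁ ∷ [])
p01-complete o₀ = here refl
p01-complete o₁ = there (here refl)

structsOfSize : ℕ → List (Struct P01)
structsOfSize n = map (mkStruct n) (functions n (functions n (o₀ ∷ o₁ ∷ [])))

structsOfSize-complete : ∀ n e → Any (Iso (mkStruct n e)) (structsOfSize n)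
structsOfSize-complete n e =
  map⁺ (Any.map Iso-pointwise
    (functions-complete (functions-complete p01-complete n) n e))

structsBelow : ℕ → List (Struct P01)
structsBelow zero    = []
structsBelow (suc n) = structsOfSize n ++ structsBelow n

structsBelow-complete : ∀ {n} (G : Struct P01) → size G < n → Any (Iso G) (structsBelow n)
structsBelow-complete {suc n} G@(mkStruct m e) m<1+n with m<1+n⇒m<n∨m≡n m<1+n
... | inj₁ m<n  = ++⁺ʳ (structsOfSize n) (structsBelow-complete G m<n)
... | inj₂ refl = ++⁺ˡ (structsOfSize-complete m e)

∃-∉ : ∀ {n} (xs : List (Fin n)) → length xs < n → ∃ λ v → v ∉ xs
∃-∉ {n} xs |xs|<n = ¬∀⟶∃¬ n (_∈ xs) (λ v → any? (v Fin.≟_) xs) not-all-covered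
  where
  not-all-covered : ¬ (∀ v → v ∈ xs)
  not-all-covered covered with pigeonhole |xs|<n (index ∘ covered)
  ... | i , j , i<j , same-index = <-irrefl (cong toℕ i≡j) i<j
    where
    open ≡-Reasoning
    i≡j : i ≡ j
    i≡j = begin
      i                             ≡⟨ lookup-index (covered i) ⟩
      lookup xs (index (covered i)) ≡⟨ cong (lookup xs) same-index ⟩
      lookup xs (index (covered j)) ≡⟨ lookup-index (covered j) ⟨
      j                             ∎

Hom-delete-edge : ∀ {P : Set} {_≼_ : P → P → Set} {n} {e : Fin (suc n) → Fin (suc n) → P}
  {H : Struct P} {v} → ((g , _) : Hom _≼_ (delete (mkStruct (suc n) e) v) H) →
  ∀ {x y} (v≢x : v ≢ x) (v≢y : v ≢ y) → e x y ≼ E H (g (punchOut v≢x)) (g (punchOut v≢y))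
Hom-delete-edge {_≼_ = _≼_} {e = e} {H} (g , g-hom) v≢x v≢y =
  subst₂ (λ x y → e x y ≼ E H (g (punchOut v≢x)) (g (punchOut v≢y)))
    (punchIn-punchOut v≢x) (punchIn-punchOut v≢y) (g-hom _ _)

side : P01 → Fin 2
side o₀ = zero
side o₁ = suc zero

-- Reading o₀, o₁ as elements of ℤ/2, this says E K2 b c = E K2 a b + E K2 a c.
K2-edge-via : ∀ a b c → E K2 b c ≡ E K2 (side (E K2 a b)) (side (E K2 a c))
K2-edge-via zero       zero       zero       = refl
K2-edge-via zero       zero       (suc zero) = refl
K2-edge-via zero       (suc zero) zero       = refl
K2-edge-via zero       (suc zero) (suc zero) = refl
K2-edge-via (suc zero) zero       zero       = refl
K2-edge-via (suc zero) zero       (suc zero) = refl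
K2-edge-via (suc zero) (suc zero) zero       = refl
K2-edge-via (suc zero) (suc zero) (suc zero) = refl

K2-hom-of-deletions : ∀ {G : Struct P01} → 4 ≤ size G →
  (∀ v → Hom _≼₀₁_ (delete G v) K2) → Hom _≼₀₁_ G K2
K2-hom-of-deletions {mkStruct (suc n) e} 4≤size homs =
  (λ x → side (e zero x)) , preserves
  where
  preserves : ∀ x y → e x y ≡ E K2 (side (e zero x)) (side (e zero y))
  preserves x y with ∃-∉ (zero ∷ x ∷ y ∷ []) 4≤size
  ... | v , v∉ = begin
    e x y                                   ≡⟨ edge v≢x v≢y ⟩
    E K2 (g′ v≢x) (g′ v≢y)                  ≡⟨ K2-edge-via (g′ v≢0) (g′ v≢x) (g′ v≢y) ⟩
    E K2 (side (E K2 (g′ v≢0) (g′ v≢x)))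
         (side (E K2 (g′ v≢0) (g′ v≢y)))    ≡⟨ cong₂ (λ p q → E K2 (side p) (side q))
                                                 (edge v≢0 v≢x) (edge v≢0 v≢y) ⟨
    E K2 (side (e zero x)) (side (e zero y)) ∎
    where
    open ≡-Reasoning
    g′ : ∀ {u} → v ≢ u → Fin 2
    g′ v≢u = proj₁ (homs v) (punchOut v≢u)
    edge : ∀ {x y} (v≢x : v ≢ x) (v≢y : v ≢ y) → e x y ≡ E K2 (g′ v≢x) (g′ v≢y)
    edge = Hom-delete-edge {_≼_ = _≼₀₁_} {e = e} {H = K2} (homs v)
    v≢0 : v ≢ zero
    v≢0 = v∉ ∘ here
    v≢x : v ≢ x
    v≢x = v∉ ∘ there ∘ here
    v≢y : v ≢ y
    v≢y = v∉ ∘ there ∘ there ∘ here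

K2-minObs-size<4 : ∀ {G} → IsMinObs _≼₀₁_ G K2 → size G < 4
K2-minObs-size<4 (¬hom , homs) = ≰⇒> (λ 4≤size → ¬hom (K2-hom-of-deletions 4≤size homs))

e₀≼K2∅-diag : ∀ c → e₀ ≼∅ E K2∅ c c
e₀≼K2∅-diag zero       = refl≼
e₀≼K2∅-diag (suc zero) = refl≼

e₀≼K2∅⇒≡ : ∀ {c d} → e₀ ≼∅ E K2∅ c d → c ≡ d
e₀≼K2∅⇒≡ {zero}     {zero}     _ = refl
e₀≼K2∅⇒≡ {suc zero} {suc zero} _ = refl
e₀≼K2∅⇒≡ {zero}     {suc zero} ()
e₀≼K2∅⇒≡ {suc zero} {zero}     ()

e₁≼K2∅⇒≢ : ∀ {c d} → e₁ ≼∅ E K2∅ c d → c ≢ d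
e₁≼K2∅⇒≢ {zero}     {zero}     () _
e₁≼K2∅⇒≢ {suc zero} {suc zero} () _

pathEdge : ℕ → ℕ → P∅
pathEdge a b with b ≟ suc a
... | yes _ = e₀
... | no  _ = e∅

-- Vertices 0, …, n with e₀ on each step i → i+1, e₁ on 0 → n and e∅ elsewhere;
-- for n ≥ 2 the e₁ edge does not collide with the step 0 → 1.
cycleEdge : ℕ → ℕ → ℕ → P∅
cycleEdge n zero b with b ≟ n
... | yes _ = e₁
... | no  _ = pathEdge zero b
cycleEdge n (suc a) b = pathEdge (suc a) b

unbalancedCycle : ℕ → Struct P∅
unbalancedCycle m = mkStruct (3 + m) (λ x y → cycleEdge (2 + m) (toℕ x) (toℕ y))

pathEdge-step : ∀ a → pathEdge a (suc a) ≡ e₀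
pathEdge-step a rewrite ≟-diag {suc a} refl = refl

cycleEdge-step : ∀ m a → cycleEdge (2 + m) a (suc a) ≡ e₀
cycleEdge-step m zero    = refl
cycleEdge-step m (suc a) = pathEdge-step (suc a)

cycleEdge-closing : ∀ n → cycleEdge n zero n ≡ e₁
cycleEdge-closing n rewrite ≟-diag {n} refl = refl

constant-along-path : ∀ {A : Set} {n} (f : Fin (suc n) → A) →
  (∀ i → f (inject₁ i) ≡ f (suc i)) → ∀ i → f i ≡ f zero
constant-along-path f step zero = refl
constant-along-path {n = suc n} f step (suc i) =
  trans (constant-along-path (f ∘ suc) (step ∘ suc) i) (sym (step zero))

unbalancedCycle-↛ : ∀ m → ¬ Hom _≼∅_ (unbalancedCycle m) K2∅
unbalancedCycle-↛ m (h , h-hom) =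
  e₁≼K2∅⇒≢ closing (sym (constant-along-path h step (fromℕ (2 + m))))
  where
  edge≼ : ∀ {x y p} → cycleEdge (2 + m) (toℕ x) (toℕ y) ≡ p → p ≼∅ E K2∅ (h x) (h y)
  edge≼ {x} {y} refl = h-hom x y
  step : ∀ i → h (inject₁ i) ≡ h (suc i)
  step i = e₀≼K2∅⇒≡ (edge≼ (trans (cong (λ a → cycleEdge (2 + m) a (suc (toℕ i))) (toℕ-inject₁ i))
                                  (cycleEdge-step m (toℕ i))))
  closing : e₁ ≼∅ E K2∅ (h zero) (h (fromℕ (2 + m)))
  closing = edge≼ (trans (cong (cycleEdge (2 + m) 0) (toℕ-fromℕ (2 + m)))
                         (cycleEdge-closing (2 + m)))

breakAt : ℕ → ℕ → Fin 2
breakAt w a with a <? w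
... | yes _ = zero
... | no  _ = suc zero

breakAt-step : ∀ {w a} → a ≢ w → suc a ≢ w → breakAt w a ≡ breakAt w (suc a)
breakAt-step {w} {a} a≢w 1+a≢w with a <? w | suc a <? w
... | yes _   | yes _    = refl
... | no  _   | no  _    = refl
... | yes a<w | no 1+a≮w = ⊥-elim (1+a≮w (≤∧≢⇒< a<w 1+a≢w))
... | no  a≮w | yes 1+a<w = ⊥-elim (a≮w (<⇒≤ 1+a<w))

pathEdge-≼ : ∀ {w a b} → a ≢ w → b ≢ w → pathEdge a b ≼∅ E K2∅ (breakAt w a) (breakAt w b)
pathEdge-≼ {w} {a} {b} a≢w b≢w with b ≟ suc a
... | yes refl rewrite breakAt-step a≢w b≢w = e₀≼K2∅-diag (breakAt w b)
... | no  _    = ∅≼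

-- Cutting the cycle at w, the vertices before w and those after it form the two sides.
cycleEdge-≼ : ∀ {n w a b} → w ≤ n → a ≢ w → b ≢ w →
  cycleEdge n a b ≼∅ E K2∅ (breakAt w a) (breakAt w b)
cycleEdge-≼ {n} {w} {zero} {b} w≤n 0≢w b≢w with b ≟ n
... | no  _    = pathEdge-≼ 0≢w b≢w
... | yes refl with 0 <? w | b <? w
...   | yes _   | no  _   = refl≼
...   | no  0≮w | _       = ⊥-elim (0≮w (≤∧≢⇒< z≤n 0≢w))
...   | yes _   | yes b<w = ⊥-elim (<⇒≱ b<w w≤n)
cycleEdge-≼ {a = suc a} _ a≢w b≢w = pathEdge-≼ a≢w b≢w

unbalancedCycle-delete : ∀ m v → Hom _≼∅_ (delete (unbalancedCycle m) v) K2∅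
unbalancedCycle-delete m v =
  (λ i → breakAt (toℕ v) (toℕ (punchIn v i))) ,
  (λ i j → cycleEdge-≼ (toℕ≤pred[n] v) (≢v i) (≢v j))
  where
  ≢v : ∀ i → toℕ (punchIn v i) ≢ toℕ v
  ≢v i = punchInᵢ≢i v i ∘ toℕ-injective

unbalancedCycle-minObs : ∀ m → IsMinObs _≼∅_ (unbalancedCycle m) K2∅
unbalancedCycle-minObs m = unbalancedCycle-↛ m , unbalancedCycle-delete m

Iso⇒size≤ : ∀ {P : Set} {G G′ : Struct P} → Iso G G′ → size G ≤ size G′
Iso⇒size≤ (f , _) = injective⇒≤ (Bijection.injective f)

size≤sum-sizes : ∀ {P : Set} (Gs : List (Struct P)) → All (λ G → size G ≤ sum (map size Gs)) Gs
size≤sum-sizes []       = []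
size≤sum-sizes (G ∷ Gs) =
  m≤m+n (size G) _ ∷ All.map (λ le → ≤-trans le (m≤n+m _ (size G))) (size≤sum-sizes Gs)

mainTheorem19 : (Σ (List (Struct P01)) λ L →
    ∀ (G : Struct P01) → IsMinObs _≼₀₁_ G K2 → Any (λ G′ → Iso G G′) L)
    ×
    (∀ (L : List (Struct P∅)) → Σ (Struct P∅) λ G →
    IsMinObs _≼∅_ G K2∅ × All (λ G′ → ¬ Iso G G′) L)
mainTheorem19 =
  (structsBelow 4 , λ G obs → structsBelow-complete G (K2-minObs-size<4 obs)) ,
  λ Gs → let s = sum (map size Gs) in
    unbalancedCycle s , unbalancedCycle-minObs s ,
    All.map (λ {G′} size≤s iso → <⇒≱ (s≤s (m≤n⇒m≤o+n 2 size≤s)) (Iso⇒size≤ {G′ = G′} iso))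
      (size≤sum-sizes Gs)
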